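{- Let $G_0=(V_0,E_0)$ be a semisimple graph, $\mathcal{M}$ a matroid on $E_0$ with rank function $r$, $G=(V,E)$ a subgraph of $G_0$, and $d\ge 1$. Suppose that $\mathcal{M}$ has the $d$-dimensional $0$-extension property, that $\delta(G)\ge d+2$, and that $G$ has an $\mathcal{M}$-seed $K\subseteq V$ and vertices $u',v'\in V-K$ with $u'\neq v'$ and $u'v'\in E$. Then there exist vertices $u,v\in V-K$ with $u\ne v$ and $uv\in E$ such that \[r(G)=r(G-u)+d=r(G-v)+d=r(G-u-v)+2d.\]
   Context: A semisimple graph has no parallel edges and at most one loop at each vertex; the degree of a vertex counts a loop once and $\delta(G)$ is the minimum degree. For a subgraph $H$ write $r(H)$ for the rank of its edge set. A subgraph $H$ is $\mathcal{M}$-independent if $r(E(H))=|E(H)|$. $N_G(x)$ is the set of vertices adjacent to $x$ in $G$ (including $x$ if there is a loop at $x$). A $d$-dimensional $0$-extension of a graph $H$ adds a new vertex $v$ and joins $v$ to $d$ distinct vertices of $V(H)+v$ (joining $v$ to itself means adding the loop $vv$). $\mathcal{M}$ has the $d$-dimensional $0$-extension property if whenever $G_1,G_2$ are subgraphs of $G_0$, $G_1$ is $\mathcal{M}$-independent and $G_2$ is a $d$-dimensional $0$-extension of $G_1$, then $G_2$ is $\mathcal{M}$-independent. A subset $K\subseteq V$ is an $\mathcal{M}$-seed of $G$ (with respect to $d$) if (i) $r(G)=r(G[K])+d|V-K|$, and (ii) for every $K'$ with $K\subseteq K'\subsetneq V$ there is $x\in V-K'$ with $|(K'+x)\cap N_G(x)|\ge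 d$. -}

module Defs where

open import Data.Nat using (ℕ; _+_; _*_; _≤_)
open import Data.Bool using (Bool; _∧_; _∨_)
open import Data.Fin using (Fin; _≟_)
open import Data.Fin.Subset using (Subset; _∈_; _∉_; _⊆_; _∩_; _∪_; _─_; ∁; ⁅_⁆; ∣_∣)
open import Data.Fin.Subset.Properties using (_∈?_)
open import Data.Vec using (tabulate)
open import Data.List using (allFin)
open import Data.Bool.ListAction using (any)
open import Data.Product using (_×_; _,_; proj₁; proj₂; Σ; ∃; ∃-syntax)
open import Data.Sum using (_⊎_)
open import Relation.Nullary using (¬_)
open import Relation.Nullary.Decidable using (⌊_⌋)
open import Relation.Binary.PropositionalEquality using (_≡_; _≢_)

-- A graph on vertex set Fin n with edge set Fin m; each edge e has two
-- endpoints (ends e); a loop at x has ends e ≡ (x , x).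
Ends : ℕ → ℕ → Set
Ends n m = Fin m → Fin n × Fin n

Joins : ∀ {n m} → Ends n m → Fin m → Fin n → Fin n → Set
Joins ends e x y = (ends e ≡ (x , y)) ⊎ (ends e ≡ (y , x))

-- semisimple: no parallel edges (hence also at most one loop per vertex)
Semisimple : ∀ {n m} → Ends n m → Set
Semisimple ends = ∀ e f x y → Joins ends e x y → Joins ends f x y → e ≡ f

record IsMatroidRank {m : ℕ} (r : Subset m → ℕ) : Set where
  field
    rank-≤-card : ∀ X → r X ≤ ∣ X ∣
    rank-mono   : ∀ X Y → X ⊆ Y → r X ≤ r Y
    rank-submod : ∀ X Y → r (X ∪ Y) + r (X ∩ Y) ≤ r X + r Y

joinsB : ∀ {n m} → Ends n m → Fin m → Fin n → Fin n → Bool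
joinsB ends e x y =
  (⌊ proj₁ (ends e) ≟ x ⌋ ∧ ⌊ proj₂ (ends e) ≟ y ⌋) ∨
  (⌊ proj₁ (ends e) ≟ y ⌋ ∧ ⌊ proj₂ (ends e) ≟ x ⌋)

inc : ∀ {n m} → Ends n m → Fin n → Subset m
inc ends x = tabulate λ e → ⌊ proj₁ (ends e) ≟ x ⌋ ∨ ⌊ proj₂ (ends e) ≟ x ⌋

within : ∀ {n m} → Ends n m → Subset n → Subset m
within ends S = tabulate λ e → ⌊ proj₁ (ends e) ∈? S ⌋ ∧ ⌊ proj₂ (ends e) ∈? S ⌋

record Subgraph {n m : ℕ} (ends : Ends n m) : Set where
  constructor subgraph
  field
    V  : Subset n
    E  : Subset m
    closed : E ⊆ within ends V
open Subgraph public

module _ {n m : ℕ} (ends : Ends n m) where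

  -- degree of x in G (a loop counts once)
  deg : Subgraph ends → Fin n → ℕ
  deg G x = ∣ E G ∩ inc ends x ∣

  MinDeg≥ : Subgraph ends → ℕ → Set
  MinDeg≥ G k = ∀ x → x ∈ V G → k ≤ deg G x

  -- N_G(x) (contains x iff there is a loop at x in G)
  N : Subgraph ends → Fin n → Subset n
  N G x = tabulate λ y → any (λ e → ⌊ e ∈? E G ⌋ ∧ joinsB ends e x y) (allFin m)

  Eind : Subgraph ends → Subset n → Subset m
  Eind G K = E G ∩ within ends K

  Edel : Subgraph ends → Fin n → Subset m
  Edel G u = E G ∩ ∁ (inc ends u)

  Edel2 : Subgraph ends → Fin n → Fin n → Subset m
  Edel2 G u v = E G ∩ ∁ (inc ends u) ∩ ∁ (inc ends v)

  EdgeIn : Subgraph ends → Fin n → Fin n → Set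
  EdgeIn G u v = ∃[ e ] (e ∈ E G × Joins ends e u v)

  module _ (r : Subset m → ℕ) where

    Indep : Subgraph ends → Set
    Indep G = r (E G) ≡ ∣ E G ∣

    -- G2 is a d-dimensional 0-extension of G1: a new vertex v is added and
    -- joined by d edges to d distinct vertices of V(G1)+v (distinctness of the
    -- neighbours is automatic since G0 is semisimple and the edges are distinct)
    ZeroExt : ℕ → Subgraph ends → Subgraph ends → Set
    ZeroExt d G1 G2 = ∃[ v ] ∃[ F ]
      ( v ∉ V G1 × V G2 ≡ V G1 ∪ ⁅ v ⁆ × E G2 ≡ E G1 ∪ F × ∣ F ∣ ≡ d
      × (∀ e → e ∈ F → Σ (Fin n) λ y → y ∈ V G2 × Joins ends e v y) )

    ZeroExtProperty : ℕ → Set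
    ZeroExtProperty d = ∀ (G1 G2 : Subgraph ends) →
      Indep G1 → ZeroExt d G1 G2 → Indep G2

    Seed : ℕ → Subgraph ends → Subset n → Set
    Seed d G K =
      K ⊆ V G
      × r (E G) ≡ r (Eind G K) + d * ∣ V G ─ K ∣
      × (∀ K' → K ⊆ K' → K' ⊆ V G → K' ≢ V G →
           ∃[ x ] (x ∈ V G × x ∉ K' × d ≤ ∣ (K' ∪ ⁅ x ⁆) ∩ N G x ∣))

-- Grow the seed K one vertex at a time while keeping an edge uv with both ends outside the grown
-- set S.  While some vertex x lies outside S ∪ {u, v}, the seed property yields w ∉ S with d
-- neighbours in S + w.  If x itself has d neighbours in S + x, add x; otherwise, as deg x ≥ d + 2,
-- x has a neighbour z outside S + x + w, so add w and make xz the new edge.  A vertex added with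
-- d neighbours among the earlier ones is a 0-extension and raises the rank by d (extend a basis and
-- apply the 0-extension property); with the seed equation this gives r(G) ≤ r(G - u - v) + 2d
-- once only u and v are left.  Conversely, restoring a vertex of which at most one neighbour is
-- missing raises the rank by d in the same way: r(G - u - v) + d ≤ r(G - u) ≤ r(G) - d, and
-- likewise for v.  These inequalities squeeze into the claimed equalities.

module Submission where

open import Defs
open import Data.Bool using (Bool; T; _∧_; _∨_)
open import Data.Bool.Properties using (T-≡; T-∧; T-∨)
open import Data.Empty using (⊥-elim)
open import Data.Fin using (Fin; _≟_)
open import Data.Fin.Subset
  using (Subset; inside; outside; _∈_; _∉_; _⊆_; _⊂_; _⊃_; _∩_; _∪_; _─_; _-_; ∁; ⁅_⁆; ∣_∣; Empty)
open import Data.Fin.Subset.Properties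
  using ( _∈?_; drop-there; nonempty?; Empty-unique; ∣⊥∣≡0; x∈⁅x⁆; x∈⁅y⁆⇔x≡y; x∉⁅y⁆⇒x≢y; ∣⁅x⁆∣≡1
        ; p⊆q⇒∣p∣≤∣q∣; x∈p∩q⁺; x∈p∩q⁻; p∩q⊆p; p∩q⊆q; p⊆p∪q; q⊆p∪q; x∈p∪q⁺; x∈p∪q⁻
        ; x∈∁p⇒x∉p; x∉p⇒x∈∁p; x∈p∧x∉q⇒x∈p─q; p─q⊆p; p─q─r≡p─q∪r
        ; x∈p∧x≢y⇒x∈p-y; x∈p⇒p-x⊂p; x∈p⇒∣p-x∣<∣p∣ )
open import Data.Fin.Subset.Induction using (Acc; acc; ⊂-wellFounded; ⊃-wellFounded)
open import Data.List using (allFin)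
open import Data.List.Membership.Propositional using (lose)
open import Data.List.Membership.Propositional.Properties using (∈-allFin)
open import Data.List.Relation.Unary.Any using (satisfied)
open import Data.List.Relation.Unary.Any.Properties using (any⁺; any⁻)
open import Data.Nat using (ℕ; suc; _+_; _*_; _≤_; _<_; z≤n; s≤s; _≤?_; _<?_) renaming (_≟_ to _≟ℕ_)
open import Data.Nat.Properties
  using (≤-trans; ≤-reflexive; ≤-antisym; ≤-pred; <⇒≤; ≤∧≢⇒<; m≤m+n; +-suc; +-identityʳ; +-comm
        ; +-monoˡ-≤; +-monoʳ-≤; +-cancelʳ-≤; +-assoc; *-suc; *-comm; *-monoʳ-≤; n≤0⇒n≡0; ≮⇒≥
        ; module ≤-Reasoning )
open import Data.Product using (_×_; _,_; proj₁; proj₂; Σ; ∃; ∃-syntax)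
import Data.Product as Product
open import Data.Product.Properties using (×-≡,≡→≡; ×-≡,≡←≡)
open import Data.Sum using (_⊎_; inj₁; inj₂)
import Data.Sum as Sum
open import Data.Vec using ([]; _∷_; tabulate; here; there)
open import Data.Vec.Properties using (lookup∘tabulate; lookup⇒[]=; []=⇒lookup)
open import Function using (_∘_; id)
open import Function.Bundles using (Equivalence)
open import Relation.Nullary using (¬_; Dec; yes; no)
open import Relation.Nullary.Decidable using (⌊_⌋; toWitness; fromWitness; decidable-stable)
open import Relation.Binary.PropositionalEquality
  using (_≡_; _≢_; refl; sym; trans; cong; cong₂; subst; module ≡-Reasoning)

open Equivalence using (to; from)

private
  variable
    n m : ℕ

module _ {A B : Set} (a? : Dec A) (b? : Dec B) where

  T-⌊⌋∧⌊⌋⁻ : T (⌊ a? ⌋ ∧ ⌊ b? ⌋) → A × B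
  T-⌊⌋∧⌊⌋⁻ t = let t₁ , t₂ = to T-∧ t in toWitness {a? = a?} t₁ , toWitness {a? = b?} t₂

  T-⌊⌋∧⌊⌋⁺ : A × B → T (⌊ a? ⌋ ∧ ⌊ b? ⌋)
  T-⌊⌋∧⌊⌋⁺ (a , b) = from T-∧ (fromWitness {a? = a?} a , fromWitness {a? = b?} b)

  T-⌊⌋∨⌊⌋⁻ : T (⌊ a? ⌋ ∨ ⌊ b? ⌋) → A ⊎ B
  T-⌊⌋∨⌊⌋⁻ t = Sum.map (toWitness {a? = a?}) (toWitness {a? = b?}) (to T-∨ t)

  T-⌊⌋∨⌊⌋⁺ : A ⊎ B → T (⌊ a? ⌋ ∨ ⌊ b? ⌋)
  T-⌊⌋∨⌊⌋⁺ a⊎b = from T-∨ (Sum.map (fromWitness {a? = a?}) (fromWitness {a? = b?}) a⊎b)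

∈-tabulate⁻ : ∀ {f : Fin n → Bool} {x} → x ∈ tabulate f → T (f x)
∈-tabulate⁻ {f = f} {x} x∈ = from T-≡ (trans (sym (lookup∘tabulate f x)) ([]=⇒lookup x∈))

∈-tabulate⁺ : ∀ {f : Fin n → Bool} {x} → T (f x) → x ∈ tabulate f
∈-tabulate⁺ {f = f} {x} t = lookup⇒[]= x (tabulate f) (trans (lookup∘tabulate f x) (to T-≡ t))

x∈p─q⁻ : ∀ (p q : Subset n) {x} → x ∈ p ─ q → x ∈ p × x ∉ q
x∈p─q⁻ (s ∷ p) (outside ∷ q) here = here , λ ()
x∈p─q⁻ (s ∷ p) (t ∷ q) (there x∈) =
  Product.map there (λ x∉q → x∉q ∘ drop-there) (x∈p─q⁻ p q x∈)

x∈p-y⁻ : ∀ {p : Subset n} {x y} → x ∈ p - y → x ∈ p × x ≢ y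
x∈p-y⁻ {p = p} {y = y} = Product.map₂ x∉⁅y⁆⇒x≢y ∘ x∈p─q⁻ p ⁅ y ⁆

x∉p-x : ∀ {p : Subset n} {x} → x ∉ p - x
x∉p-x x∈ = proj₂ (x∈p-y⁻ x∈) refl

x∉p∪q⁻ : ∀ {p q : Subset n} {x} → x ∉ p ∪ q → x ∉ p × x ∉ q
x∉p∪q⁻ x∉ = x∉ ∘ x∈p∪q⁺ ∘ inj₁ , x∉ ∘ x∈p∪q⁺ ∘ inj₂

x∉p∪⁅y⁆⁺ : ∀ {p : Subset n} {x y} → x ∉ p → x ≢ y → x ∉ p ∪ ⁅ y ⁆
x∉p∪⁅y⁆⁺ {p = p} x∉p x≢y x∈ = Sum.[ x∉p , x≢y ∘ to x∈⁅y⁆⇔x≡y ] (x∈p∪q⁻ p _ x∈)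

∪-lub : ∀ {p q s : Subset n} → p ⊆ s → q ⊆ s → p ∪ q ⊆ s
∪-lub {p = p} p⊆s q⊆s x∈ = Sum.[ p⊆s , q⊆s ] (x∈p∪q⁻ p _ x∈)

p⊆p-x∪⁅x⁆ : ∀ {p : Subset n} {x} → p ⊆ (p - x) ∪ ⁅ x ⁆
p⊆p-x∪⁅x⁆ {x = x} {y} y∈p with y ≟ x
... | yes y≡x = x∈p∪q⁺ (inj₂ (from x∈⁅y⁆⇔x≡y y≡x))
... | no y≢x = x∈p∪q⁺ (inj₁ (x∈p∧x≢y⇒x∈p-y y∈p y≢x))

⊈⇒∃∉ : ∀ {p q : Subset n} → ¬ (p ⊆ q) → ∃ λ x → x ∈ p × x ∉ q
⊈⇒∃∉ {p = p} {q} p⊈q with nonempty? (p ─ q)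
... | yes (x , x∈) = x , x∈p─q⁻ p q x∈
... | no p─q-empty = ⊥-elim (p⊈q λ {x} x∈p →
        decidable-stable (x ∈? q) (λ x∉q → p─q-empty (x , x∈p∧x∉q⇒x∈p─q x∈p x∉q)))

Empty⇒∣p∣≡0 : ∀ {p : Subset n} → Empty p → ∣ p ∣ ≡ 0
Empty⇒∣p∣≡0 {n} p-empty = trans (cong ∣_∣ (Empty-unique p-empty)) (∣⊥∣≡0 n)

∣p∪q∣+∣p∩q∣≡∣p∣+∣q∣ : ∀ (p q : Subset n) → ∣ p ∪ q ∣ + ∣ p ∩ q ∣ ≡ ∣ p ∣ + ∣ q ∣
∣p∪q∣+∣p∩q∣≡∣p∣+∣q∣ [] [] = refl
∣p∪q∣+∣p∩q∣≡∣p∣+∣q∣ (inside ∷ p) (inside ∷ q) =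
  cong suc (trans (+-suc _ _) (trans (cong suc (∣p∪q∣+∣p∩q∣≡∣p∣+∣q∣ p q)) (sym (+-suc _ _))))
∣p∪q∣+∣p∩q∣≡∣p∣+∣q∣ (inside ∷ p) (outside ∷ q) = cong suc (∣p∪q∣+∣p∩q∣≡∣p∣+∣q∣ p q)
∣p∪q∣+∣p∩q∣≡∣p∣+∣q∣ (outside ∷ p) (inside ∷ q) =
  trans (cong suc (∣p∪q∣+∣p∩q∣≡∣p∣+∣q∣ p q)) (sym (+-suc _ _))
∣p∪q∣+∣p∩q∣≡∣p∣+∣q∣ (outside ∷ p) (outside ∷ q) = ∣p∪q∣+∣p∩q∣≡∣p∣+∣q∣ p q

∣p∪q∣≤∣p∣+∣q∣ : ∀ (p q : Subset n) → ∣ p ∪ q ∣ ≤ ∣ p ∣ + ∣ q ∣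
∣p∪q∣≤∣p∣+∣q∣ p q = ≤-trans (m≤m+n _ _) (≤-reflexive (∣p∪q∣+∣p∩q∣≡∣p∣+∣q∣ p q))

disjoint⇒∣p∪q∣≡∣p∣+∣q∣ : ∀ (p q : Subset n) → (∀ {x} → x ∈ p → x ∉ q) → ∣ p ∪ q ∣ ≡ ∣ p ∣ + ∣ q ∣
disjoint⇒∣p∪q∣≡∣p∣+∣q∣ p q disjoint = begin
  ∣ p ∪ q ∣               ≡⟨ sym (+-identityʳ _) ⟩
  ∣ p ∪ q ∣ + 0           ≡⟨ cong (∣ p ∪ q ∣ +_) (sym (Empty⇒∣p∣≡0 p∩q-empty)) ⟩
  ∣ p ∪ q ∣ + ∣ p ∩ q ∣   ≡⟨ ∣p∪q∣+∣p∩q∣≡∣p∣+∣q∣ p q ⟩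
  ∣ p ∣ + ∣ q ∣           ∎
  where
  open ≡-Reasoning
  p∩q-empty : Empty (p ∩ q)
  p∩q-empty (x , x∈) = let x∈p , x∈q = x∈p∩q⁻ p q x∈ in disjoint x∈p x∈q

p⊆q∪⁅x⁆⇒∣p∣≤suc∣q∣ : ∀ {p q : Subset n} {x} → p ⊆ q ∪ ⁅ x ⁆ → ∣ p ∣ ≤ suc ∣ q ∣
p⊆q∪⁅x⁆⇒∣p∣≤suc∣q∣ {p = p} {q} {x} p⊆ = begin
  ∣ p ∣             ≤⟨ p⊆q⇒∣p∣≤∣q∣ p⊆ ⟩
  ∣ q ∪ ⁅ x ⁆ ∣       ≤⟨ ∣p∪q∣≤∣p∣+∣q∣ q ⁅ x ⁆ ⟩
  ∣ q ∣ + ∣ ⁅ x ⁆ ∣     ≡⟨ cong (∣ q ∣ +_) (∣⁅x⁆∣≡1 x) ⟩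
  ∣ q ∣ + 1           ≡⟨ +-comm ∣ q ∣ 1 ⟩
  suc ∣ q ∣           ∎
  where open ≤-Reasoning

∣p∣≤suc∣p-x∣ : ∀ (p : Subset n) x → ∣ p ∣ ≤ suc ∣ p - x ∣
∣p∣≤suc∣p-x∣ p x = p⊆q∪⁅x⁆⇒∣p∣≤suc∣q∣ {q = p - x} (p⊆p-x∪⁅x⁆ {p = p} {x = x})

injection⇒∣p∣≤∣q∣ : ∀ (f : Fin m → Fin n) {p : Subset m} {q : Subset n} →
  (∀ {x} → x ∈ p → f x ∈ q) → (∀ {x y} → x ∈ p → y ∈ p → f x ≡ f y → x ≡ y) → ∣ p ∣ ≤ ∣ q ∣
injection⇒∣p∣≤∣q∣ f {p} = go (⊂-wellFounded p)
  where
  open ≤-Reasoning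
  go : ∀ {p q} → Acc _⊂_ p → (∀ {x} → x ∈ p → f x ∈ q) →
    (∀ {x y} → x ∈ p → y ∈ p → f x ≡ f y → x ≡ y) → ∣ p ∣ ≤ ∣ q ∣
  go {p} {q} (acc rec) maps injective with nonempty? p
  ... | no p-empty = ≤-trans (≤-reflexive (Empty⇒∣p∣≡0 p-empty)) z≤n
  ... | yes (x , x∈p) = begin
    ∣ p ∣           ≤⟨ ∣p∣≤suc∣p-x∣ p x ⟩
    suc ∣ p - x ∣   ≤⟨ s≤s (go (rec (x∈p⇒p-x⊂p x∈p)) maps′ injective′) ⟩
    suc ∣ q - f x ∣ ≤⟨ x∈p⇒∣p-x∣<∣p∣ (maps x∈p) ⟩
    ∣ q ∣           ∎
    where
    maps′ : ∀ {y} → y ∈ p - x → f y ∈ q - f x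
    maps′ y∈ = let y∈p , y≢x = x∈p-y⁻ y∈ in
      x∈p∧x≢y⇒x∈p-y (maps y∈p) (y≢x ∘ injective y∈p x∈p)
    injective′ : ∀ {y z} → y ∈ p - x → z ∈ p - x → f y ≡ f z → y ≡ z
    injective′ y∈ z∈ = injective (proj₁ (x∈p-y⁻ y∈)) (proj₁ (x∈p-y⁻ z∈))

surjection⇒∣q∣≤∣p∣ : ∀ (f : Fin m → Fin n) {p : Subset m} {q : Subset n} →
  (∀ {y} → y ∈ q → ∃ λ x → x ∈ p × f x ≡ y) → ∣ q ∣ ≤ ∣ p ∣
surjection⇒∣q∣≤∣p∣ f {p} = go (⊂-wellFounded p)
  where
  open ≤-Reasoning
  go : ∀ {p q} → Acc _⊂_ p → (∀ {y} → y ∈ q → ∃ λ x → x ∈ p × f x ≡ y) → ∣ q ∣ ≤ ∣ p ∣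
  go {p} {q} (acc rec) onto with nonempty? p
  ... | no p-empty = ≤-trans (≤-reflexive (Empty⇒∣p∣≡0 q-empty)) z≤n
    where
    q-empty : Empty q
    q-empty (y , y∈q) = let x , x∈p , _ = onto y∈q in p-empty (x , x∈p)
  ... | yes (x , x∈p) = begin
    ∣ q ∣           ≤⟨ ∣p∣≤suc∣p-x∣ q (f x) ⟩
    suc ∣ q - f x ∣ ≤⟨ s≤s (go (rec (x∈p⇒p-x⊂p x∈p)) onto′) ⟩
    suc ∣ p - x ∣   ≤⟨ x∈p⇒∣p-x∣<∣p∣ x∈p ⟩
    ∣ p ∣           ∎
    where
    onto′ : ∀ {y} → y ∈ q - f x → ∃ λ x′ → x′ ∈ p - x × f x′ ≡ y
    onto′ y∈ =
      let y∈q , y≢fx = x∈p-y⁻ y∈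
          x′ , x′∈p , fx′≡y = onto y∈q
      in x′ , x∈p∧x≢y⇒x∈p-y x′∈p (λ x′≡x → y≢fx (trans (sym fx′≡y) (cong f x′≡x))) , fx′≡y

subset-of-size : ∀ {k} (p : Subset n) → k ≤ ∣ p ∣ → ∃ λ q → q ⊆ p × ∣ q ∣ ≡ k
subset-of-size {k = k} p = go (⊂-wellFounded p)
  where
  go : ∀ {p} → Acc _⊂_ p → k ≤ ∣ p ∣ → ∃ λ q → q ⊆ p × ∣ q ∣ ≡ k
  go {p} (acc rec) k≤∣p∣ with ∣ p ∣ ≟ℕ k
  ... | yes ∣p∣≡k = p , id , ∣p∣≡k
  ... | no ∣p∣≢k with nonempty? p
  ...   | no p-empty = ⊥-elim (∣p∣≢k (≤-antisym (≤-reflexive (trans ∣p∣≡0 (sym k≡0))) k≤∣p∣))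
    where
    ∣p∣≡0 = Empty⇒∣p∣≡0 p-empty
    k≡0 = n≤0⇒n≡0 (≤-trans k≤∣p∣ (≤-reflexive ∣p∣≡0))
  ...   | yes (x , x∈p) =
    let q , q⊆p-x , ∣q∣≡k = go (rec (x∈p⇒p-x⊂p x∈p)) k≤∣p-x∣ in q , p─q⊆p p ⁅ x ⁆ ∘ q⊆p-x , ∣q∣≡k
    where
    k≤∣p-x∣ : k ≤ ∣ p - x ∣
    k≤∣p-x∣ = ≤-pred (≤-trans (≤∧≢⇒< k≤∣p∣ (∣p∣≢k ∘ sym)) (∣p∣≤suc∣p-x∣ p x))

module MatroidRank {r : Subset m → ℕ} (isRank : IsMatroidRank r) where
  open IsMatroidRank isRank

  r-mono : ∀ {X Y} → X ⊆ Y → r X ≤ r Y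
  r-mono = rank-mono _ _

  record Basis (X : Subset m) : Set where
    field
      B           : Subset m
      B⊆X         : B ⊆ X
      independent : r B ≡ ∣ B ∣
      spanning    : r B ≡ r X

  basis-insert : ∀ {X e} → e ∈ X → r (X - e) < r X → Basis (X - e) → Basis X
  basis-insert {X} {e} e∈X rank-grows basis-of-X-e = record
    { B           = B ∪ ⁅ e ⁆
    ; B⊆X         = ∪-lub (p─q⊆p X ⁅ e ⁆ ∘ B⊆X)
                          (λ x∈⁅e⁆ → subst (_∈ X) (sym (to x∈⁅y⁆⇔x≡y x∈⁅e⁆)) e∈X)
    ; independent = ≤-antisym (rank-≤-card (B ∪ ⁅ e ⁆)) (≤-trans ∣B+e∣≤rX rX≤rB+e)
    ; spanning    = ≤-antisym (≤-trans (rank-≤-card (B ∪ ⁅ e ⁆)) ∣B+e∣≤rX) rX≤rB+e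
    }
    where
    open Basis basis-of-X-e
    open ≤-Reasoning
    Y = X - e
    ∣B+e∣≤rX : ∣ B ∪ ⁅ e ⁆ ∣ ≤ r X
    ∣B+e∣≤rX = begin
      ∣ B ∪ ⁅ e ⁆ ∣     ≡⟨ disjoint⇒∣p∪q∣≡∣p∣+∣q∣ B ⁅ e ⁆ (λ x∈B x∈⁅e⁆ →
                             x∉p-x (subst (_∈ Y) (to x∈⁅y⁆⇔x≡y x∈⁅e⁆) (B⊆X x∈B))) ⟩
      ∣ B ∣ + ∣ ⁅ e ⁆ ∣   ≡⟨ cong₂ _+_ (trans (sym independent) spanning) (∣⁅x⁆∣≡1 e) ⟩
      r Y + 1           ≡⟨ +-comm (r Y) 1 ⟩
      suc (r Y)         ≤⟨ rank-grows ⟩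
      r X               ∎
    X⊆B+e∪Y : X ⊆ (B ∪ ⁅ e ⁆) ∪ Y
    X⊆B+e∪Y = ∪-lub (q⊆p∪q (B ∪ ⁅ e ⁆) Y) (p⊆p∪q Y ∘ q⊆p∪q B ⁅ e ⁆) ∘ p⊆p-x∪⁅x⁆ {x = e}
    B⊆B+e∩Y : B ⊆ (B ∪ ⁅ e ⁆) ∩ Y
    B⊆B+e∩Y x∈B = x∈p∩q⁺ (p⊆p∪q ⁅ e ⁆ x∈B , B⊆X x∈B)
    rX≤rB+e : r X ≤ r (B ∪ ⁅ e ⁆)
    rX≤rB+e = +-cancelʳ-≤ (r Y) (r X) (r (B ∪ ⁅ e ⁆)) (begin
      r X + r Y                                  ≡⟨ cong (r X +_) (sym spanning) ⟩
      r X + r B                                  ≤⟨ +-monoˡ-≤ (r B) (r-mono X⊆B+e∪Y) ⟩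
      r ((B ∪ ⁅ e ⁆) ∪ Y) + r B                   ≤⟨ +-monoʳ-≤ _ (r-mono B⊆B+e∩Y) ⟩
      r ((B ∪ ⁅ e ⁆) ∪ Y) + r ((B ∪ ⁅ e ⁆) ∩ Y)   ≤⟨ rank-submod (B ∪ ⁅ e ⁆) Y ⟩
      r (B ∪ ⁅ e ⁆) + r Y                        ∎)

  basis : ∀ X → Basis X
  basis X = go (⊂-wellFounded X)
    where
    go : ∀ {X} → Acc _⊂_ X → Basis X
    go {X} (acc rec) with nonempty? X
    ... | no X-empty = record
      { B = X ; B⊆X = id ; independent = trans rX≡0 (sym ∣X∣≡0) ; spanning = refl }
      where
      ∣X∣≡0 = Empty⇒∣p∣≡0 X-empty
      rX≡0 = n≤0⇒n≡0 (≤-trans (rank-≤-card X) (≤-reflexive ∣X∣≡0))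
    ... | yes (e , e∈X) with r (X - e) <? r X
    ...   | yes rank-grows = basis-insert e∈X rank-grows (go (rec (x∈p⇒p-x⊂p e∈X)))
    ...   | no rank-same = record
      { B = B ; B⊆X = p─q⊆p X ⁅ e ⁆ ∘ B⊆X ; independent = independent
      ; spanning = trans spanning (≤-antisym (r-mono (p─q⊆p X ⁅ e ⁆)) (≮⇒≥ rank-same)) }
      where open Basis (go (rec (x∈p⇒p-x⊂p e∈X)))

module Incidence (ends : Ends n m) where

  within⁻ : ∀ {A e} → e ∈ within ends A → proj₁ (ends e) ∈ A × proj₂ (ends e) ∈ A
  within⁻ {A} {e} e∈ = T-⌊⌋∧⌊⌋⁻ (proj₁ (ends e) ∈? A) (proj₂ (ends e) ∈? A) (∈-tabulate⁻ e∈)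

  within⁺ : ∀ {A e} → proj₁ (ends e) ∈ A → proj₂ (ends e) ∈ A → e ∈ within ends A
  within⁺ {A} {e} p₁∈A p₂∈A =
    ∈-tabulate⁺ (T-⌊⌋∧⌊⌋⁺ (proj₁ (ends e) ∈? A) (proj₂ (ends e) ∈? A) (p₁∈A , p₂∈A))

  inc⁻ : ∀ {x e} → e ∈ inc ends x → proj₁ (ends e) ≡ x ⊎ proj₂ (ends e) ≡ x
  inc⁻ {x} {e} e∈ = T-⌊⌋∨⌊⌋⁻ (proj₁ (ends e) ≟ x) (proj₂ (ends e) ≟ x) (∈-tabulate⁻ e∈)

  inc⁺ : ∀ {x e} → proj₁ (ends e) ≡ x ⊎ proj₂ (ends e) ≡ x → e ∈ inc ends x
  inc⁺ {x} {e} ends≡x = ∈-tabulate⁺ (T-⌊⌋∨⌊⌋⁺ (proj₁ (ends e) ≟ x) (proj₂ (ends e) ≟ x) ends≡x)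

  private
    ends≡⁻ : ∀ {e a b} → T (⌊ proj₁ (ends e) ≟ a ⌋ ∧ ⌊ proj₂ (ends e) ≟ b ⌋) → ends e ≡ (a , b)
    ends≡⁻ {e} {a} {b} t = ×-≡,≡→≡ (T-⌊⌋∧⌊⌋⁻ (proj₁ (ends e) ≟ a) (proj₂ (ends e) ≟ b) t)

    ends≡⁺ : ∀ {e a b} → ends e ≡ (a , b) → T (⌊ proj₁ (ends e) ≟ a ⌋ ∧ ⌊ proj₂ (ends e) ≟ b ⌋)
    ends≡⁺ {e} {a} {b} eq = T-⌊⌋∧⌊⌋⁺ (proj₁ (ends e) ≟ a) (proj₂ (ends e) ≟ b) (×-≡,≡←≡ eq)

  joinsB⁻ : ∀ {e x y} → T (joinsB ends e x y) → Joins ends e x y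
  joinsB⁻ t = Sum.map ends≡⁻ ends≡⁻ (to T-∨ t)

  joinsB⁺ : ∀ {e x y} → Joins ends e x y → T (joinsB ends e x y)
  joinsB⁺ j = from T-∨ (Sum.map ends≡⁺ ends≡⁺ j)

  N⁻ : ∀ {G x y} → y ∈ N ends G x → EdgeIn ends G x y
  N⁻ y∈N =
    let e , t = satisfied (any⁻ _ (allFin m) (∈-tabulate⁻ y∈N))
        e∈E , j = to T-∧ t
    in e , toWitness e∈E , joinsB⁻ j

  N⁺ : ∀ {G x y} → EdgeIn ends G x y → y ∈ N ends G x
  N⁺ (e , e∈E , j) =
    ∈-tabulate⁺ (any⁺ _ (lose (∈-allFin e) (from T-∧ (fromWitness e∈E , joinsB⁺ j))))

  joins-ends : ∀ {e x y} → Joins ends e x y →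
    (x ≡ proj₁ (ends e) × y ≡ proj₂ (ends e)) ⊎ (x ≡ proj₂ (ends e) × y ≡ proj₁ (ends e))
  joins-ends (inj₁ eq) = inj₁ (×-≡,≡←≡ (sym eq))
  joins-ends (inj₂ eq) = inj₂ (Product.swap (×-≡,≡←≡ (sym eq)))

  joins-inc : ∀ {e x y} → Joins ends e x y → e ∈ inc ends x
  joins-inc j with joins-ends j
  ... | inj₁ (refl , _) = inc⁺ (inj₁ refl)
  ... | inj₂ (refl , _) = inc⁺ (inj₂ refl)

  joins-unique : ∀ {e x y y′} → Joins ends e x y → Joins ends e x y′ → y ≡ y′
  joins-unique j j′ with joins-ends j | joins-ends j′
  ... | inj₁ (_ , refl)     | inj₁ (_ , refl)     = refl
  ... | inj₁ (x≡p₁ , refl)  | inj₂ (x≡p₂ , refl)  = trans (sym x≡p₂) x≡p₁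
  ... | inj₂ (x≡p₂ , refl)  | inj₁ (x≡p₁ , refl)  = trans (sym x≡p₁) x≡p₂
  ... | inj₂ (_ , refl)     | inj₂ (_ , refl)     = refl

  joins-within⁻ : ∀ {A e x y} → Joins ends e x y → e ∈ within ends A → x ∈ A × y ∈ A
  joins-within⁻ j e∈ with joins-ends j | within⁻ e∈
  ... | inj₁ (refl , refl) | p₁∈A , p₂∈A = p₁∈A , p₂∈A
  ... | inj₂ (refl , refl) | p₁∈A , p₂∈A = p₂∈A , p₁∈A

  joins-within⁺ : ∀ {A e x y} → Joins ends e x y → x ∈ A → y ∈ A → e ∈ within ends A
  joins-within⁺ j x∈A y∈A with joins-ends j
  ... | inj₁ (refl , refl) = within⁺ x∈A y∈A
  ... | inj₂ (refl , refl) = within⁺ y∈A x∈A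

  within-mono : ∀ {A A′} → A ⊆ A′ → within ends A ⊆ within ends A′
  within-mono A⊆A′ e∈ = let p₁∈A , p₂∈A = within⁻ e∈ in within⁺ (A⊆A′ p₁∈A) (A⊆A′ p₂∈A)

  within⇒∉inc : ∀ {A e u} → e ∈ within ends A → u ∉ A → e ∉ inc ends u
  within⇒∉inc e∈ u∉A e∈inc with within⁻ e∈ | inc⁻ e∈inc
  ... | p₁∈A , _ | inj₁ refl = u∉A p₁∈A
  ... | _ , p₂∈A | inj₂ refl = u∉A p₂∈A

  ∉inc⇒within- : ∀ {A e u} → e ∈ within ends A → e ∉ inc ends u → e ∈ within ends (A - u)
  ∉inc⇒within- e∈ e∉inc = let p₁∈A , p₂∈A = within⁻ e∈ in
    within⁺ (x∈p∧x≢y⇒x∈p-y p₁∈A (e∉inc ∘ inc⁺ ∘ inj₁)) (x∈p∧x≢y⇒x∈p-y p₂∈A (e∉inc ∘ inc⁺ ∘ inj₂))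

  other : Fin n → Fin m → Fin n
  other x e with proj₁ (ends e) ≟ x
  ... | yes _ = proj₂ (ends e)
  ... | no _  = proj₁ (ends e)

  other-joins : ∀ {x e} → e ∈ inc ends x → Joins ends e x (other x e)
  other-joins {x} {e} e∈inc with proj₁ (ends e) ≟ x | inc⁻ e∈inc
  ... | yes refl  | _         = inj₁ refl
  ... | no p₁≢x   | inj₁ p₁≡x = ⊥-elim (p₁≢x p₁≡x)
  ... | no _      | inj₂ refl = inj₂ refl

  N⊆V : ∀ {G x} → N ends G x ⊆ V G
  N⊆V {G} {x} y∈N = let e , e∈E , j = N⁻ {G} {x} y∈N in proj₂ (joins-within⁻ j (closed G e∈E))

  neighbours≤edges : ∀ G {A x} → x ∈ A → ∣ A ∩ N ends G x ∣ ≤ ∣ Eind ends G A ∩ inc ends x ∣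
  neighbours≤edges G {A} {x} x∈A = surjection⇒∣q∣≤∣p∣ (other x) onto
    where
    onto : ∀ {y} → y ∈ A ∩ N ends G x → ∃ λ e → e ∈ Eind ends G A ∩ inc ends x × other x e ≡ y
    onto y∈ =
      let y∈A , y∈N = x∈p∩q⁻ A _ y∈
          e , e∈E , j = N⁻ {G} y∈N
      in e , x∈p∩q⁺ (x∈p∩q⁺ (e∈E , joins-within⁺ j x∈A y∈A) , joins-inc j)
        , joins-unique (other-joins (joins-inc j)) j

  deg≤∣N∣ : Semisimple ends → ∀ G x → deg ends G x ≤ ∣ N ends G x ∣
  deg≤∣N∣ semisimple G x = injection⇒∣p∣≤∣q∣ (other x) into injective
    where
    into : ∀ {e} → e ∈ E G ∩ inc ends x → other x e ∈ N ends G x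
    into {e} e∈ = let e∈E , e∈inc = x∈p∩q⁻ (E G) _ e∈ in N⁺ {G} (e , e∈E , other-joins e∈inc)
    injective : ∀ {e f} → e ∈ E G ∩ inc ends x → f ∈ E G ∩ inc ends x →
      other x e ≡ other x f → e ≡ f
    injective {e} {f} e∈ f∈ same-other = semisimple e f x (other x e)
      (other-joins (proj₂ (x∈p∩q⁻ (E G) _ e∈)))
      (subst (Joins ends f x) (sym same-other) (other-joins (proj₂ (x∈p∩q⁻ (E G) _ f∈))))

module ZeroExtensionRank {ends : Ends n m} {r : Subset m → ℕ} (isRank : IsMatroidRank r) {d : ℕ}
                         (zero-ext : ZeroExtProperty ends r d) where
  open Incidence ends
  open MatroidRank isRank

  zero-extension-rank : ∀ {W x X F} → x ∉ W → X ⊆ within ends W → ∣ F ∣ ≡ d →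
    (∀ e → e ∈ F → Σ (Fin n) λ y → y ∈ W ∪ ⁅ x ⁆ × Joins ends e x y) → r X + d ≤ r (X ∪ F)
  zero-extension-rank {W} {x} {X} {F} x∉W X⊆W ∣F∣≡d F-at-x = begin
    r X + d        ≡⟨ cong₂ _+_ (trans (sym spanning) independent) (sym ∣F∣≡d) ⟩
    ∣ B ∣ + ∣ F ∣    ≡⟨ sym (disjoint⇒∣p∪q∣≡∣p∣+∣q∣ B F B∩F-empty) ⟩
    ∣ B ∪ F ∣       ≡⟨ sym (zero-ext G₁ G₂ independent extension) ⟩
    r (B ∪ F)      ≤⟨ r-mono (∪-lub (p⊆p∪q F ∘ B⊆X) (q⊆p∪q X F)) ⟩
    r (X ∪ F)      ∎
    where
    open Basis (basis X)
    open ≤-Reasoning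
    F⊆within : F ⊆ within ends (W ∪ ⁅ x ⁆)
    F⊆within e∈F = let y , y∈ , j = F-at-x _ e∈F in joins-within⁺ j (x∈p∪q⁺ (inj₂ (x∈⁅x⁆ x))) y∈
    G₁ : Subgraph ends
    G₁ = subgraph W B (X⊆W ∘ B⊆X)
    G₂ : Subgraph ends
    G₂ = subgraph (W ∪ ⁅ x ⁆) (B ∪ F) (∪-lub (within-mono (p⊆p∪q ⁅ x ⁆) ∘ X⊆W ∘ B⊆X) F⊆within)
    extension : ZeroExt ends r d G₁ G₂
    extension = x , F , x∉W , refl , refl , ∣F∣≡d , F-at-x
    B∩F-empty : ∀ {e} → e ∈ B → e ∉ F
    B∩F-empty e∈B e∈F =
      let _ , _ , j = F-at-x _ e∈F in x∉W (proj₁ (joins-within⁻ j (X⊆W (B⊆X e∈B))))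

  rank-gain : ∀ G {W x X Y} → x ∉ W → X ⊆ within ends W → d ≤ ∣ (W ∪ ⁅ x ⁆) ∩ N ends G x ∣ →
    X ⊆ Y → Eind ends G (W ∪ ⁅ x ⁆) ⊆ Y → r X + d ≤ r Y
  rank-gain G {W} {x} x∉W X⊆W enough X⊆Y Eind⊆Y =
    let F , F⊆ , ∣F∣≡d = subset-of-size Fx (≤-trans enough (neighbours≤edges G x∈W+x))
    in ≤-trans (zero-extension-rank x∉W X⊆W ∣F∣≡d (λ _ → at-x ∘ F⊆))
               (r-mono (∪-lub X⊆Y (Eind⊆Y ∘ p∩q⊆p _ _ ∘ F⊆)))
    where
    x∈W+x = x∈p∪q⁺ (inj₂ (x∈⁅x⁆ x))
    Fx = Eind ends G (W ∪ ⁅ x ⁆) ∩ inc ends x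
    at-x : ∀ {e} → e ∈ Fx → Σ (Fin n) λ y → y ∈ W ∪ ⁅ x ⁆ × Joins ends e x y
    at-x {e} e∈ =
      let e∈Eind , e∈inc = x∈p∩q⁻ (Eind ends G (W ∪ ⁅ x ⁆)) _ e∈
          j = other-joins e∈inc
      in other x e , proj₂ (joins-within⁻ j (proj₂ (x∈p∩q⁻ (E G) _ e∈Eind))) , j

module EdgeDeletion {ends : Ends n m} (G : Subgraph ends) where
  open Incidence ends

  ∈Edel⁻ : ∀ {u e} → e ∈ Edel ends G u → e ∈ E G × e ∉ inc ends u
  ∈Edel⁻ e∈ = Product.map₂ x∈∁p⇒x∉p (x∈p∩q⁻ (E G) _ e∈)

  ∈Edel⁺ : ∀ {u e} → e ∈ E G → e ∉ inc ends u → e ∈ Edel ends G u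
  ∈Edel⁺ e∈E e∉inc = x∈p∩q⁺ (e∈E , x∉p⇒x∈∁p e∉inc)

  ∈Edel2⁻ : ∀ {u v e} → e ∈ Edel2 ends G u v → e ∈ Edel ends G u × e ∉ inc ends v
  ∈Edel2⁻ {u} e∈ =
    let e∈E , e∈∁∁ = x∈p∩q⁻ (E G) _ e∈
        e∉u , e∉v = x∈p∩q⁻ (∁ (inc ends u)) _ e∈∁∁
    in x∈p∩q⁺ (e∈E , e∉u) , x∈∁p⇒x∉p e∉v

  ∈Edel2⁺ : ∀ {u v e} → e ∈ Edel ends G u → e ∉ inc ends v → e ∈ Edel2 ends G u v
  ∈Edel2⁺ e∈ e∉v = let e∈E , e∉u = ∈Edel⁻ e∈ in
    x∈p∩q⁺ (e∈E , x∈p∩q⁺ (x∉p⇒x∈∁p e∉u , x∉p⇒x∈∁p e∉v))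

  Edel2-swap : ∀ {u v} → Edel2 ends G u v ⊆ Edel2 ends G v u
  Edel2-swap e∈ =
    let e∈Edel , e∉v = ∈Edel2⁻ e∈
        e∈E , e∉u = ∈Edel⁻ e∈Edel
    in ∈Edel2⁺ (∈Edel⁺ e∈E e∉v) e∉u

  Eind⊆Edel : ∀ {A u} → u ∉ A → Eind ends G A ⊆ Edel ends G u
  Eind⊆Edel u∉A e∈ = let e∈E , e∈A = x∈p∩q⁻ (E G) _ e∈ in ∈Edel⁺ e∈E (within⇒∉inc e∈A u∉A)

  Edel⊆within : ∀ {u} → Edel ends G u ⊆ within ends (V G - u)
  Edel⊆within e∈ = let e∈E , e∉inc = ∈Edel⁻ e∈ in ∉inc⇒within- (closed G e∈E) e∉inc

module VertexDeletion {ends : Ends n m} (semisimple : Semisimple ends)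
                      {r : Subset m → ℕ} (isRank : IsMatroidRank r) (G : Subgraph ends) {d : ℕ}
                      (zero-ext : ZeroExtProperty ends r d) (minDeg : MinDeg≥ ends G (2 + d)) where
  open Incidence ends
  open MatroidRank isRank
  open ZeroExtensionRank isRank zero-ext
  open EdgeDeletion G

  most-neighbours-in : ∀ {A x w} → x ∈ V G → N ends G x ⊆ A ∪ ⁅ w ⁆ → suc d ≤ ∣ A ∩ N ends G x ∣
  most-neighbours-in {A} {x} {w} x∈V N⊆A+w = ≤-pred (begin
    2 + d                    ≤⟨ minDeg x x∈V ⟩
    deg ends G x             ≤⟨ deg≤∣N∣ semisimple G x ⟩
    ∣ N ends G x ∣           ≤⟨ p⊆q∪⁅x⁆⇒∣p∣≤suc∣q∣ {q = A ∩ N ends G x} N⊆ ⟩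
    suc ∣ A ∩ N ends G x ∣   ∎)
    where
    open ≤-Reasoning
    N⊆ : N ends G x ⊆ (A ∩ N ends G x) ∪ ⁅ w ⁆
    N⊆ y∈N = Sum.[ (λ y∈A → x∈p∪q⁺ (inj₁ (x∈p∩q⁺ (y∈A , y∈N)))) , x∈p∪q⁺ ∘ inj₂ ]
                  (x∈p∪q⁻ A _ (N⊆A+w y∈N))

  deletion-gain : ∀ {W x w X Y} → x ∈ V G → x ∉ W → (∀ {y} → y ∈ V G → y ∉ W → y ≢ x → y ≡ w) →
    X ⊆ within ends W → X ⊆ Y → Eind ends G (W ∪ ⁅ x ⁆) ⊆ Y → r X + d ≤ r Y
  deletion-gain {W} {x} {w} x∈V x∉W only-w X⊆W =
    rank-gain G x∉W X⊆W (<⇒≤ (most-neighbours-in x∈V N⊆))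
    where
    N⊆ : N ends G x ⊆ (W ∪ ⁅ x ⁆) ∪ ⁅ w ⁆
    N⊆ {y} y∈N with y ∈? W ∪ ⁅ x ⁆
    ... | yes y∈W+x = x∈p∪q⁺ (inj₁ y∈W+x)
    ... | no y∉W+x =
      let y∉W , y∉⁅x⁆ = x∉p∪q⁻ y∉W+x
      in x∈p∪q⁺ (inj₂ (from x∈⁅y⁆⇔x≡y (only-w (N⊆V {G} y∈N) y∉W (x∉⁅y⁆⇒x≢y y∉⁅x⁆))))

  Edel-gain : ∀ {u} → u ∈ V G → r (Edel ends G u) + d ≤ r (E G)
  Edel-gain {u} u∈V = deletion-gain {w = u} u∈V x∉p-x only-u Edel⊆within (p∩q⊆p _ _) (p∩q⊆p _ _)
    where
    only-u : ∀ {y} → y ∈ V G → y ∉ V G - u → y ≢ u → y ≡ u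
    only-u y∈V y∉V-u y≢u = ⊥-elim (y∉V-u (x∈p∧x≢y⇒x∈p-y y∈V y≢u))

  Edel2-gain : ∀ {u v} → v ∈ V G → u ≢ v → r (Edel2 ends G u v) + d ≤ r (Edel ends G u)
  Edel2-gain {u} {v} v∈V u≢v = deletion-gain v∈V x∉p-x only-u Edel2⊆within (proj₁ ∘ ∈Edel2⁻)
    (Eind⊆Edel (x∉p∪⁅y⁆⁺ (x∉p-x ∘ p─q⊆p (V G - u) ⁅ v ⁆) u≢v))
    where
    only-u : ∀ {y} → y ∈ V G → y ∉ V G - u - v → y ≢ v → y ≡ u
    only-u {y} y∈V y∉W y≢v =
      decidable-stable (y ≟ u) (λ y≢u → y∉W (x∈p∧x≢y⇒x∈p-y (x∈p∧x≢y⇒x∈p-y y∈V y≢u) y≢v))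
    Edel2⊆within : Edel2 ends G u v ⊆ within ends (V G - u - v)
    Edel2⊆within e∈ = let e∈Edel , e∉v = ∈Edel2⁻ e∈ in ∉inc⇒within- (Edel⊆within e∈Edel) e∉v

  module SeedGrowth {K : Subset n} (seed : Seed ends r d G K) where

    -- S stands for K followed by vertices each having d neighbours among the earlier ones and
    -- itself; of that history only the rank estimate it implies is kept.
    record Admissible (S : Subset n) : Set where
      field
        K⊆S        : K ⊆ S
        S⊆V        : S ⊆ V G
        rank-bound : r (E G) ≤ r (Eind ends G S) + d * ∣ V G ─ S ∣

    record EdgeOutside (S : Subset n) : Set where
      constructor edge-outside
      field
        u v  : Fin n
        u∈V  : u ∈ V G
        v∈V  : v ∈ V G
        u∉S  : u ∉ S
        v∉S  : v ∉ S
        u≢v  : u ≢ v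
        uv∈E : EdgeIn ends G u v

    Exhausted : (S : Subset n) → EdgeOutside S → Set
    Exhausted S f = ∀ {y} → y ∈ V G → y ∉ S → y ≢ EdgeOutside.u f → y ≡ EdgeOutside.v f

    seed-admissible : Admissible K
    seed-admissible = record
      { K⊆S = id ; S⊆V = proj₁ seed ; rank-bound = ≤-reflexive (proj₁ (proj₂ seed)) }

    extend : ∀ {S x} → Admissible S → x ∈ V G → x ∉ S → d ≤ ∣ (S ∪ ⁅ x ⁆) ∩ N ends G x ∣ →
      Admissible (S ∪ ⁅ x ⁆)
    extend {S} {x} adm x∈V x∉S enough = record
      { K⊆S        = p⊆p∪q ⁅ x ⁆ ∘ K⊆S
      ; S⊆V        = ∪-lub S⊆V (λ y∈⁅x⁆ → subst (_∈ V G) (sym (to x∈⁅y⁆⇔x≡y y∈⁅x⁆)) x∈V)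
      ; rank-bound = begin
          r (E G)                                  ≤⟨ rank-bound ⟩
          r (Eind ends G S) + d * ∣ V G ─ S ∣      ≤⟨ +-monoʳ-≤ _ (*-monoʳ-≤ d ∣V─S∣≤) ⟩
          r (Eind ends G S) + d * suc k           ≡⟨ cong (r (Eind ends G S) +_) (*-suc d k) ⟩
          r (Eind ends G S) + (d + d * k)         ≡⟨ sym (+-assoc (r (Eind ends G S)) d (d * k)) ⟩
          r (Eind ends G S) + d + d * k           ≤⟨ +-monoˡ-≤ (d * k) gain ⟩
          r (Eind ends G (S ∪ ⁅ x ⁆)) + d * k     ∎
      }
      where
      open Admissible adm
      open ≤-Reasoning
      k = ∣ V G ─ (S ∪ ⁅ x ⁆) ∣
      ∣V─S∣≤ : ∣ V G ─ S ∣ ≤ suc k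
      ∣V─S∣≤ = subst (λ q → ∣ V G ─ S ∣ ≤ suc ∣ q ∣) (p─q─r≡p─q∪r (V G) S ⁅ x ⁆)
                     (∣p∣≤suc∣p-x∣ (V G ─ S) x)
      Eind-mono : Eind ends G S ⊆ Eind ends G (S ∪ ⁅ x ⁆)
      Eind-mono e∈ = let e∈E , e∈S = x∈p∩q⁻ (E G) _ e∈ in
        x∈p∩q⁺ (e∈E , within-mono (p⊆p∪q ⁅ x ⁆) e∈S)
      gain : r (Eind ends G S) + d ≤ r (Eind ends G (S ∪ ⁅ x ⁆))
      gain = rank-gain G x∉S (p∩q⊆q _ _) enough Eind-mono id

    step : ∀ {S} → Admissible S → (f : EdgeOutside S) → ∀ {x} → x ∈ V G → x ∉ S →
      x ≢ EdgeOutside.u f → x ≢ EdgeOutside.v f →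
      ∃ λ y → y ∉ S × Admissible (S ∪ ⁅ y ⁆) × EdgeOutside (S ∪ ⁅ y ⁆)
    step {S} adm f {x} x∈V x∉S x≢u x≢v
      with proj₂ (proj₂ seed) S K⊆S S⊆V (λ S≡V → x∉S (subst (x ∈_) (sym S≡V) x∈V))
      where open Admissible adm
    ... | w , w∈V , w∉S , w-enough with d ≤? ∣ (S ∪ ⁅ x ⁆) ∩ N ends G x ∣
    ...   | yes x-enough = x , x∉S , extend adm x∈V x∉S x-enough
      , edge-outside u v u∈V v∈V (x∉p∪⁅y⁆⁺ u∉S (x≢u ∘ sym)) (x∉p∪⁅y⁆⁺ v∉S (x≢v ∘ sym)) u≢v uv∈E
      where open EdgeOutside f
    ...   | no x-short =
      let z , z∈N , z∉ = ⊈⇒∃∉ (x-short ∘ <⇒≤ ∘ most-neighbours-in x∈V)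
          z∉S+x , z∉⁅w⁆ = x∉p∪q⁻ z∉
          z∉S , z∉⁅x⁆ = x∉p∪q⁻ z∉S+x
      in w , w∉S , extend adm w∈V w∉S w-enough
         , edge-outside x z x∈V (N⊆V {G} z∈N) (x∉p∪⁅y⁆⁺ x∉S x≢w)
             (x∉p∪⁅y⁆⁺ z∉S (x∉⁅y⁆⇒x≢y z∉⁅w⁆)) (x∉⁅y⁆⇒x≢y z∉⁅x⁆ ∘ sym) (N⁻ {G} z∈N)
      where
      x≢w : x ≢ w
      x≢w refl = x-short w-enough

    grow : ∀ {S} → Acc _⊃_ S → Admissible S → (f : EdgeOutside S) →
      ∃ λ S′ → Admissible S′ × Σ (EdgeOutside S′) (Exhausted S′)
    grow {S} (acc rec) adm f with nonempty? (V G ─ S - EdgeOutside.u f - EdgeOutside.v f)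
    ... | no none = S , adm , f , λ {y} y∈V y∉S y≢u →
      decidable-stable (y ≟ EdgeOutside.v f) λ y≢v →
        none (y , x∈p∧x≢y⇒x∈p-y (x∈p∧x≢y⇒x∈p-y (x∈p∧x∉q⇒x∈p─q y∈V y∉S) y≢u) y≢v)
    ... | yes (x , x∈) =
      let x∈V-S-u , x≢v = x∈p-y⁻ x∈
          x∈V-S , x≢u = x∈p-y⁻ x∈V-S-u
          x∈V , x∉S = x∈p─q⁻ (V G) S x∈V-S
          y , y∉S , adm′ , f′ = step adm f x∈V x∉S x≢u x≢v
      in grow (rec (p⊆p∪q ⁅ y ⁆ , y , x∈p∪q⁺ (inj₂ (x∈⁅x⁆ y)) , y∉S)) adm′ f′

    exhausted-bound : ∀ {S} → Admissible S → (f : EdgeOutside S) → Exhausted S f →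
      r (E G) ≤ r (Edel2 ends G (EdgeOutside.u f) (EdgeOutside.v f)) + 2 * d
    exhausted-bound {S} adm f exhausted = begin
      r (E G)                               ≤⟨ rank-bound ⟩
      r (Eind ends G S) + d * ∣ V G ─ S ∣   ≤⟨ +-monoʳ-≤ _ (*-monoʳ-≤ d ∣V─S∣≤2) ⟩
      r (Eind ends G S) + d * 2            ≡⟨ cong (r (Eind ends G S) +_) (*-comm d 2) ⟩
      r (Eind ends G S) + 2 * d            ≤⟨ +-monoˡ-≤ (2 * d) (r-mono Eind⊆Edel2) ⟩
      r (Edel2 ends G u v) + 2 * d         ∎
      where
      open Admissible adm
      open EdgeOutside f
      open ≤-Reasoning
      V─S⊆ : V G ─ S ⊆ ⁅ u ⁆ ∪ ⁅ v ⁆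
      V─S⊆ {y} y∈ with x∈p─q⁻ (V G) S y∈ | y ≟ u
      ... | _          | yes y≡u = x∈p∪q⁺ (inj₁ (from x∈⁅y⁆⇔x≡y y≡u))
      ... | y∈V , y∉S  | no y≢u  = x∈p∪q⁺ (inj₂ (from x∈⁅y⁆⇔x≡y (exhausted y∈V y∉S y≢u)))
      ∣V─S∣≤2 : ∣ V G ─ S ∣ ≤ 2
      ∣V─S∣≤2 = ≤-trans (p⊆q∪⁅x⁆⇒∣p∣≤suc∣q∣ {q = ⁅ u ⁆} V─S⊆) (s≤s (≤-reflexive (∣⁅x⁆∣≡1 u)))
      Eind⊆Edel2 : Eind ends G S ⊆ Edel2 ends G u v
      Eind⊆Edel2 e∈ = ∈Edel2⁺ (Eind⊆Edel u∉S e∈) (within⇒∉inc (proj₂ (x∈p∩q⁻ (E G) _ e∈)) v∉S)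

squeeze : ∀ {a b c d} → b + d ≤ a → c + d ≤ b → a ≤ c + 2 * d → a ≡ b + d × a ≡ c + 2 * d
squeeze {a} {b} {c} {d} b+d≤a c+d≤b a≤c+2d =
  ≤-antisym (≤-trans a≤c+2d c+2d≤b+d) b+d≤a , ≤-antisym a≤c+2d (≤-trans c+2d≤b+d b+d≤a)
  where
  c+2d≤b+d : c + 2 * d ≤ b + d
  c+2d≤b+d = begin
    c + 2 * d    ≡⟨ cong (λ t → c + (d + t)) (+-identityʳ d) ⟩
    c + (d + d)  ≡⟨ sym (+-assoc c d d) ⟩
    c + d + d    ≤⟨ +-monoˡ-≤ d c+d≤b ⟩
    b + d        ∎
    where open ≤-Reasoning

lemma3p3 : ∀ {n m : ℕ} (ends : Ends n m) → Semisimple ends →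
    (r : Subset m → ℕ) → IsMatroidRank r →
    (G : Subgraph ends) (d : ℕ) → 1 ≤ d →
    ZeroExtProperty ends r d →
    MinDeg≥ ends G (2 + d) →
    (K : Subset n) → Seed ends r d G K →
    (u' v' : Fin n) → u' ∈ V G → u' ∉ K → v' ∈ V G → v' ∉ K → u' ≢ v' → EdgeIn ends G u' v' →
    ∃[ u ] ∃[ v ] ( u ∈ V G × u ∉ K × v ∈ V G × v ∉ K × u ≢ v × EdgeIn ends G u v
      × r (E G) ≡ r (Edel ends G u) + d
      × r (E G) ≡ r (Edel ends G v) + d
      × r (E G) ≡ r (Edel2 ends G u v) + 2 * d )
lemma3p3 ends semisimple r isRank G d _ zero-ext minDeg K seed
         u′ v′ u′∈V u′∉K v′∈V v′∉K u′≢v′ u′v′∈E =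
  let S , adm , f , exhausted = grow (⊃-wellFounded K) seed-admissible
                                     (edge-outside u′ v′ u′∈V v′∈V u′∉K v′∉K u′≢v′ u′v′∈E)
      open Admissible adm
      open EdgeOutside f
      upper = exhausted-bound adm f exhausted
      u-side = squeeze (Edel-gain u∈V) (Edel2-gain v∈V u≢v) upper
      v-side = squeeze (Edel-gain v∈V)
                 (≤-trans (+-monoˡ-≤ d (r-mono Edel2-swap)) (Edel2-gain u∈V (u≢v ∘ sym))) upper
  in u , v , u∈V , u∉S ∘ K⊆S , v∈V , v∉S ∘ K⊆S , u≢v , uv∈E
     , proj₁ u-side , proj₁ v-side , proj₂ u-side
  where
  open MatroidRank isRank
  open EdgeDeletion G
  open VertexDeletion semisimple isRank G zero-ext minDeg
  open SeedGrowth seed
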